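{- Let $n\ge 3$ be an integer and define $\hbar(i,j)=i^{ -1}\sqrt{i^2+j^2}$. Then for every pair of integers $(i,j)$ with $1\le i\le j\le n-1$ and $(i,j)\ne(1,n-1)$, $$\hbar(i,j)-\frac{n-1}{n}\left(\frac{1}{i}+\frac{1}{j}\right)\hbar(1,n-1)<0.$$ -}

module Defs where

open import Data.Nat using (ℕ; zero; suc; _+_; _*_)
open import Data.Integer using (+_)
open import Data.Rational using (ℚ; _/_) renaming (_*_ to _*ℚ_; _+_ to _+ℚ_)
open import Data.Rational using (0ℚ)

-- frac p q = p / q as a rational; the value at q = 0 is an arbitrary
-- convention (0) and is never used by the statement (all denominators ≥ 1).
frac : ℕ → ℕ → ℚ
frac p zero    = 0ℚ
frac p (suc q) = (+ p) / suc q

hbarSq : ℕ → ℕ → ℚ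
hbarSq i j = frac (i * i + j * j) (i * i)

coeff : ℕ → ℕ → ℕ → ℚ
coeff n i j = frac (n Data.Nat.∸ 1) n *ℚ (frac 1 i +ℚ frac 1 j)

{-# OPTIONS --safe #-}
-- With m = n - 1, multiplying both sides by i² j² / (i + j)² turns the claim into
--   (i² + j²) j² / (i + j)²  <  m² (1 + m²) / (1 + m)².
-- For 1 ≤ i ≤ j the left side is antitone in i: cross-multiplied, its deficit against the
-- value at i = 1 is 2 j³ (i - 1) (j² - i), positive once i ≥ 2.  That value at i = 1 is
-- x² (1 + x²) / (1 + x)² at x = j, which is strictly increasing in x, so it is at most the
-- right side; one of the two steps is strict unless (i, j) = (1, m).
module Submission where

module NatBounds where
  open import Data.Nat
  open import Data.Nat.Properties
  open import Data.Nat.Tactic.RingSolver using (solve-∀; solve)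
  open import Algebra.Properties.CommutativeSemigroup *-commutativeSemigroup using (xy∙z≈xz∙y)
  open import Data.List using (_∷_; [])
  open import Data.Product using (_×_; _,_)
  open import Data.Sum using (inj₁; inj₂)
  open import Data.Empty using (⊥-elim)
  open import Relation.Binary.PropositionalEquality using (_≡_; refl)
  open import Relation.Nullary using (¬_)
  open ≤-Reasoning

  -- a * d < c * b  encodes  a / b < c / d.
  cross-<-≤-trans : ∀ {a b c d e f} .{{_ : NonZero d}} .{{_ : NonZero f}} →
                    a * d < c * b → c * f ≤ e * d → a * f < e * b
  cross-<-≤-trans {a} {b} {c} {d} {e} {f} ad<cb cf≤ed = *-cancelʳ-< d (a * f) (e * b) (begin-strict
    a * f * d  ≡⟨ xy∙z≈xz∙y a f d ⟩
    a * d * f  <⟨ *-monoˡ-< f ad<cb ⟩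
    c * b * f  ≡⟨ xy∙z≈xz∙y c b f ⟩
    c * f * b  ≤⟨ *-monoˡ-≤ b cf≤ed ⟩
    e * d * b  ≡⟨ xy∙z≈xz∙y e d b ⟩
    e * b * d  ∎)

  cross-≤-<-trans : ∀ {a b c d e f} .{{_ : NonZero b}} .{{_ : NonZero d}} →
                    a * d ≤ c * b → c * f < e * d → a * f < e * b
  cross-≤-<-trans {a} {b} {c} {d} {e} {f} ad≤cb cf<ed = *-cancelʳ-< d (a * f) (e * b) (begin-strict
    a * f * d  ≡⟨ xy∙z≈xz∙y a f d ⟩
    a * d * f  ≤⟨ *-monoˡ-≤ f ad≤cb ⟩
    c * b * f  ≡⟨ xy∙z≈xz∙y c b f ⟩
    c * f * b  <⟨ *-monoˡ-< b cf<ed ⟩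
    e * d * b  ≡⟨ xy∙z≈xz∙y e d b ⟩
    e * b * d  ∎)

  module _ (p q : ℕ → ℕ) (q-nonZero : ∀ x → NonZero (q x))
           (step : ∀ x → p x * q (suc x) < p (suc x) * q x) where

    cross-strictMono : ∀ {x y} → x < y → p x * q y < p y * q x
    cross-strictMono {x} {suc y} x<1+y with m<1+n⇒m<n∨m≡n x<1+y
    ... | inj₂ refl = step x
    ... | inj₁ x<y  = cross-<-≤-trans {a = p x} {c = p y} {e = p (suc y)}
                        {{q-nonZero y}} {{q-nonZero (suc y)}}
                        (cross-strictMono x<y) (<⇒≤ (step y))

    cross-mono : ∀ {x y} → x ≤ y → p x * q y ≤ p y * q x
    cross-mono x≤y with m≤n⇒m<n∨m≡n x≤y
    ... | inj₁ x<y  = <⇒≤ (cross-strictMono x<y)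
    ... | inj₂ refl = ≤-refl

  -- num₁ j / den₁ j is (i² + j²) j² / (i + j)² at i = 1.
  num₁ den₁ : ℕ → ℕ
  num₁ x = x * x * (1 + x * x)
  den₁ x = (1 + x) * (1 + x)

  num₁/den₁-gap : ∀ x → x * x * (1 + x * x) * ((2 + x) * (2 + x))
                          + (2 + x * (10 + x * (17 + x * (20 + x * (11 + 2 * x)))))
                        ≡ (1 + x) * (1 + x) * (1 + (1 + x) * (1 + x)) * ((1 + x) * (1 + x))
  num₁/den₁-gap = solve-∀

  num₁/den₁-step : ∀ x → num₁ x * den₁ (suc x) < num₁ (suc x) * den₁ x
  num₁/den₁-step x = <-≤-trans (m<m+n _ z<s) (≤-reflexive (num₁/den₁-gap x))

  sumSqRatio-gap : ∀ a b → let i = 1 + a ; j = 1 + a + b in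
    (i * i + j * j) * (j * j) * ((1 + j) * (1 + j))
      + 2 * (j * j * j) * a * (a * (1 + a) + 2 * (1 + a) * b + b * b)
    ≡ j * j * (1 + j * j) * ((i + j) * (i + j))
  sumSqRatio-gap = solve-∀

  sumSqRatio-antitone : ∀ {i j} → 1 ≤ i → i ≤ j →
                        (i * i + j * j) * (j * j) * den₁ j ≤ num₁ j * ((i + j) * (i + j))
  sumSqRatio-antitone {suc a} _ i≤j with m≤n⇒∃[o]m+o≡n i≤j
  ... | b , refl = ≤-trans (m≤m+n _ _) (≤-reflexive (sumSqRatio-gap a b))

  sumSqRatio-strictAntitone : ∀ {i j} → 2 ≤ i → i ≤ j →
                              (i * i + j * j) * (j * j) * den₁ j < num₁ j * ((i + j) * (i + j))
  sumSqRatio-strictAntitone {suc zero} (s≤s ())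
  sumSqRatio-strictAntitone {suc (suc a)} _ i≤j with m≤n⇒∃[o]m+o≡n i≤j
  -- with a successor for a, the gap is a product of successors, so it computes to one
  ... | b , refl = <-≤-trans (m<m+n _ z<s) (≤-reflexive (sumSqRatio-gap (suc a) b))

  sumSqRatio<num₁/den₁ : ∀ {i j m} → 1 ≤ i → i ≤ j → j ≤ m → ¬ (i ≡ 1 × j ≡ m) →
                         (i * i + j * j) * (j * j) * den₁ m < num₁ m * ((i + j) * (i + j))
  sumSqRatio<num₁/den₁ {i@(suc zero)} {j} {m} 1≤i i≤j j≤m i,j≢1,m with m≤n⇒m<n∨m≡n j≤m
  ... | inj₁ j<m = cross-≤-<-trans {a = (i * i + j * j) * (j * j)} {c = num₁ j} {e = num₁ m}
                     (sumSqRatio-antitone 1≤i i≤j)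
                     (cross-strictMono num₁ den₁ (λ _ → _) num₁/den₁-step j<m)
  ... | inj₂ j≡m = ⊥-elim (i,j≢1,m (refl , j≡m))
  sumSqRatio<num₁/den₁ {i@(suc (suc _))} {j} {m} _ i≤j j≤m _ =
    cross-<-≤-trans {a = (i * i + j * j) * (j * j)} {c = num₁ j} {e = num₁ m}
      (sumSqRatio-strictAntitone (s≤s (s≤s z≤n)) i≤j)
      (cross-mono num₁ den₁ (λ _ → _) num₁/den₁-step j≤m)

  hbarSq<coeff²hbarSq-cleared : ∀ {i j m} → 1 ≤ i → i ≤ j → j ≤ m → ¬ (i ≡ 1 × j ≡ m) →
                                (i * i + j * j) * (suc m * (i * j) * (suc m * (i * j)))
                                  < m * (j + i) * (m * (j + i)) * (1 + m * m) * (i * i)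
  hbarSq<coeff²hbarSq-cleared {i} {j} {m} 1≤i i≤j j≤m i,j≢1,m = begin-strict
    (i * i + j * j) * (suc m * (i * j) * (suc m * (i * j)))   ≡⟨ solve (i ∷ j ∷ m ∷ []) ⟩
    (i * i + j * j) * (j * j) * ((1 + m) * (1 + m)) * (i * i) <⟨ *-monoˡ-< (i * i) {{i*i≢0}}
                                                                   (sumSqRatio<num₁/den₁ 1≤i i≤j j≤m i,j≢1,m) ⟩
    m * m * (1 + m * m) * ((i + j) * (i + j)) * (i * i)       ≡⟨ solve (i ∷ j ∷ m ∷ []) ⟩
    m * (j + i) * (m * (j + i)) * (1 + m * m) * (i * i)       ∎
    where i*i≢0 = m*n≢0 i i {{>-nonZero 1≤i}} {{>-nonZero 1≤i}}

module RationalForm where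
  open import Defs
  open import Data.Nat
  open import Data.Nat.Properties using (*-identityˡ; *-identityʳ)
  open import Relation.Binary.PropositionalEquality using (sym; cong₂; subst₂)
  open import Data.Integer using (+_; +<+)
  open import Data.Rational as ℚ using (ℚ; toℚᵘ)
  open import Data.Rational.Properties using (toℚᵘ-fromℚᵘ; toℚᵘ-homo-*; toℚᵘ-homo-+; toℚᵘ-cancel-<)
  open import Data.Rational.Unnormalised as ℚᵘ using (ℚᵘ; mkℚᵘ; _≃_; *<*)
  open import Data.Rational.Unnormalised.Properties
    using (≃-trans; ≃-sym; *-cong; +-cong; <-respˡ-≃; <-respʳ-≃)

  toℚᵘ-frac : ∀ p q .{{_ : NonZero q}} → toℚᵘ (frac p q) ≃ + p ℚᵘ./ q
  toℚᵘ-frac p (suc q) = toℚᵘ-fromℚᵘ (mkℚᵘ (+ p) q)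

  toℚᵘ-coeff : ∀ n i j .{{_ : NonZero n}} .{{_ : NonZero i}} .{{_ : NonZero j}} →
               toℚᵘ (coeff n i j) ≃ (+ (n ∸ 1) ℚᵘ./ n) ℚᵘ.* (+ 1 ℚᵘ./ i ℚᵘ.+ + 1 ℚᵘ./ j)
  toℚᵘ-coeff n i j = ≃-trans (toℚᵘ-homo-* (frac (n ∸ 1) n) (frac 1 i ℚ.+ frac 1 j))
    (*-cong (toℚᵘ-frac (n ∸ 1) n)
            (≃-trans (toℚᵘ-homo-+ (frac 1 i) (frac 1 j)) (+-cong (toℚᵘ-frac 1 i) (toℚᵘ-frac 1 j))))

  hbarSq<coeff²hbarSq : ∀ {i j m} → 1 ≤ i → 1 ≤ j → 1 ≤ m →
                        (i * i + j * j) * (suc m * (i * j) * (suc m * (i * j)))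
                          < m * (j + i) * (m * (j + i)) * (1 + m * m) * (i * i) →
                        hbarSq i j ℚ.< (coeff (suc m) i j ℚ.* coeff (suc m) i j) ℚ.* hbarSq 1 m
  hbarSq<coeff²hbarSq {i@(suc _)} {j@(suc _)} {m@(suc _)} _ _ _ cleared =
    toℚᵘ-cancel-< (<-respˡ-≃ (≃-sym lhs) (<-respʳ-≃ (≃-sym rhs) (*<* (+<+ cross-multiplied))))
    where
    C : ℚ
    C = coeff (suc m) i j

    c : ℚᵘ
    c = (+ m ℚᵘ./ suc m) ℚᵘ.* (+ 1 ℚᵘ./ i ℚᵘ.+ + 1 ℚᵘ./ j)

    lhs : toℚᵘ (hbarSq i j) ≃ + (i * i + j * j) ℚᵘ./ (i * i)
    lhs = toℚᵘ-frac (i * i + j * j) (i * i)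

    rhs : toℚᵘ ((C ℚ.* C) ℚ.* hbarSq 1 m) ≃ (c ℚᵘ.* c) ℚᵘ.* (+ (1 + m * m) ℚᵘ./ 1)
    rhs = ≃-trans (toℚᵘ-homo-* (C ℚ.* C) (hbarSq 1 m))
            (*-cong (≃-trans (toℚᵘ-homo-* C C) (*-cong (toℚᵘ-coeff (suc m) i j) (toℚᵘ-coeff (suc m) i j)))
                    (toℚᵘ-frac (1 + m * m) 1))

    N : ℕ
    N = suc m * (i * j)

    -- ℚᵘ compares  ↥ p * ↧ q  with  ↥ q * ↧ p ; here that comparison is written in the
    -- form it reduces to, with the unit factors left by the ℚᵘ operations.
    cross-multiplied : (i * i + j * j) * (N * N * 1)
                         < m * (1 * j + 1 * i) * (m * (1 * j + 1 * i)) * (1 + m * m) * (i * i)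
    cross-multiplied =
      subst₂ (λ x y → (i * i + j * j) * x < m * y * (m * y) * (1 + m * m) * (i * i))
             (sym (*-identityʳ (N * N))) (sym (cong₂ _+_ (*-identityˡ j) (*-identityˡ i))) cleared

open import Defs
open import Data.Nat using (ℕ; _≤_; _∸_)
open import Data.Product using (_×_)
open import Data.Rational using (_<_; _*_)
open import Relation.Binary.PropositionalEquality using (_≡_)
open import Relation.Nullary using (¬_)

open import Data.Nat using (suc)
open import Data.Nat.Properties using (≤-trans)
open NatBounds using (hbarSq<coeff²hbarSq-cleared)
open RationalForm using (hbarSq<coeff²hbarSq)

lemma2 : ∀ (n i j : ℕ) → 3 ≤ n → 1 ≤ i → i ≤ j → j ≤ n ∸ 1 → ¬ (i ≡ 1 × j ≡ n ∸ 1) →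
    hbarSq i j < (coeff n i j * coeff n i j) * hbarSq 1 (n ∸ 1)
lemma2 (suc m) i j _ 1≤i i≤j j≤m i,j≢1,m =
  hbarSq<coeff²hbarSq 1≤i 1≤j (≤-trans 1≤j j≤m) (hbarSq<coeff²hbarSq-cleared 1≤i i≤j j≤m i,j≢1,m)
  where 1≤j = ≤-trans 1≤i i≤j
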